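{- Let $S$ be a fully-transpositional function semigroup on a set $A$ with $|A|\notin\{1,2,6\}$ which contains no constant function and no semi-constant function, and let $f\in S$ satisfy $|\mathbf B(f)|\leq2$. Then either (i) $f$ is a permutation of $A$ and $\{x\in A: f(x)\neq x\}$ is finite, or (ii) $A\setminus(\mathrm{Mo\text{ - }pre}(f)\cup\mathrm{Idp}(f))$ is infinite. In case (i), $f\in\mathrm{Gr}(S)$.
   Context: A function semigroup on $A$ is a nonempty $S\subseteq A^A$ closed under composition; fully-transpositional means it contains every transposition of $A$ (permutation moving exactly two elements). $g\colon A\to A$ is semi-constant if there is $B\subseteq A$ with $|B|\geq2$ such that $g\restriction B$ is constant and $g\restriction(A\setminus B)$ is the identity. For $f\colon A\to A$: $[a]_f=\{x: f(x)=f(a)\}$; $\mathbf B(f)=\{[a]_f: |[a]_f|\geq2\}$; $\mathrm{Mo\text{ - }pre}(f)=\bigcup\mathbf B(f)$; $\mathrm{Idp}(f)=\{a: f^{ -1}[\{a\}]=\{a\}\}$. $\mathrm{Gr}(S)=\{g\in S: g\text{ is a permutation of }A\text{ and }g^{ -1}\in S\}$. -}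

module Defs where

open import Level using (0ℓ)
open import Data.Nat using (ℕ)
open import Data.Fin using (Fin)
open import Data.Product using (Σ; ∃; _×_; _,_)
open import Data.Sum using (_⊎_)
open import Relation.Nullary using (¬_)
open import Relation.Binary.PropositionalEquality using (_≡_; _≢_)
open import Function using (_∘_; _↔_)
open import Function.Definitions using (Bijective)

-- Subsets of A are predicates A → Set; a "function set" on A is a predicate on A → A.

HasSize : Set → ℕ → Set
HasSize X n = X ↔ Fin n

Finite : Set → Set
Finite X = Σ ℕ (HasSize X)

Infinite : Set → Set
Infinite X = ¬ Finite X

module _ {A : Set} where

  -- S is a function semigroup on A: nonempty and closed under composition.
  -- Functions are extensional objects, so membership is invariant under pointwise equality.
  record FunctionSemigroup (S : (A → A) → Set) : Set where
    field
      nonempty : Σ (A → A) S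
      closed   : ∀ {f g} → S f → S g → S (f ∘ g)
      extensional : ∀ {f g} → (∀ x → f x ≡ g x) → S f → S g

  IsTransposition : (A → A) → Set
  IsTransposition t = Σ A λ a → Σ A λ b → a ≢ b × t a ≡ b × t b ≡ a
                        × (∀ x → x ≢ a → x ≢ b → t x ≡ x)

  FullyTranspositional : ((A → A) → Set) → Set
  FullyTranspositional S = ∀ a b → a ≢ b → Σ (A → A) λ t → S t × t a ≡ b × t b ≡ a
                             × (∀ x → x ≢ a → x ≢ b → t x ≡ x)

  AtLeastTwo : (A → Set) → Set
  AtLeastTwo B = Σ A λ x → Σ A λ y → x ≢ y × B x × B y

  IsConstant : (A → A) → Set
  IsConstant g = ∀ x y → g x ≡ g y

  IsSemiConstant : (A → A) → Set₁
  IsSemiConstant g = Σ (A → Set) λ B → AtLeastTwo B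
                       × (∀ x y → B x → B y → g x ≡ g y)
                       × (∀ x → ¬ B x → g x ≡ x)

  Class : (A → A) → A → (A → Set)
  Class f a x = f x ≡ f a

  InB : (A → A) → A → Set
  InB f a = AtLeastTwo (Class f a)

  SameSet : (A → Set) → (A → Set) → Set
  SameSet P Q = ∀ x → (P x → Q x) × (Q x → P x)

  BAtMostTwo : (A → A) → Set
  BAtMostTwo f = ∀ a₁ a₂ a₃ → InB f a₁ → InB f a₂ → InB f a₃ →
                   SameSet (Class f a₁) (Class f a₂)
                   ⊎ (SameSet (Class f a₁) (Class f a₃)
                   ⊎ SameSet (Class f a₂) (Class f a₃))

  MoPre : (A → A) → A → Set
  MoPre f x = Σ A λ a → InB f a × Class f a x

  Idp : (A → A) → A → Set
  Idp f a = ∀ x → (f x ≡ a → x ≡ a) × (x ≡ a → f x ≡ a)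

  IsPermutation : (A → A) → Set
  IsPermutation f = Bijective _≡_ _≡_ f

  InGr : ((A → A) → Set) → (A → A) → Set
  InGr S g = S g × IsPermutation g
             × Σ (A → A) λ h → S h × (∀ x → h (g x) ≡ x) × (∀ x → g (h x) ≡ x)

module Submission where

-- Let Rest f be the set of points outside Mo-pre(f) ∪ Idp(f).  If Rest f is
-- infinite we are in case (ii), so assume it is finite.
--   * If B(f) = ∅, f is injective, its support is a retract of Rest f, hence
--     finite, and an injective map of finite support is onto: case (i).
--   * If B(f) ≠ ∅, f maps the complement of Idp(f) into a finite set (the at
--     most two values of f on Mo-pre(f) and the images of the rest points).
--     Composing with permutations from S that send two distinct image points
--     onto two points of one class of B(f) shrinks this image until it is a
--     single point, giving a semi-constant map in S: impossible.
-- In case (i) the inverse of f is again injective of finite support, hence a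
-- product of transpositions, hence in S, so f ∈ Gr(S).

open import Level using (0ℓ)
open import Axiom.ExcludedMiddle using (ExcludedMiddle)
open import Data.Bool using (Bool; true; false; T; if_then_else_)
open import Data.Bool.Properties using (T-irrelevant)
open import Data.Empty using (⊥-elim)
open import Data.Fin using (Fin; zero; suc; _≟_)
open import Data.Fin.Properties using (+↔⊎; ¬Fin0)
open import Data.Nat using (ℕ; zero; suc; _+_)
open import Data.Product using (Σ; ∃; _×_; _,_; proj₁; proj₂)
open import Data.Sum using (_⊎_; inj₁; inj₂)
open import Data.Sum.Function.Propositional using (_⊎-↔_)
open import Data.Vec.Functional using (_∷_)
open import Function using (_∘_; _↔_; Inverse; mk↔ₛ′)
open import Function.Definitions using (Injective; StrictlySurjective)
open import Function.Consequences.Propositional using (strictlySurjective⇒surjective)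
open import Function.Properties.Inverse using (↔-trans; ↔-sym)
open import Relation.Nullary using (¬_; yes; no)
open import Relation.Nullary.Decidable using (⌊_⌋; fromWitness; toWitness; decidable-stable)
open import Relation.Binary.PropositionalEquality
  using (_≡_; _≢_; refl; sym; trans; cong; subst; module ≡-Reasoning)
open import Defs

-- Finite types

subset-≡ : {X : Set} {P : X → Bool} {x y : X} {t : T (P x)} {u : T (P y)} →
           x ≡ y → _≡_ {A = Σ X (T ∘ P)} (x , t) (y , u)
subset-≡ {t = t} {u} refl = cong (_ ,_) (T-irrelevant t u)

Σ-Fin-suc : ∀ {n} (Q : Fin (suc n) → Set) →
            Σ (Fin (suc n)) Q ↔ (Q zero ⊎ Σ (Fin n) (Q ∘ suc))
Σ-Fin-suc Q = mk↔ₛ′ split join (λ { (inj₁ _) → refl ; (inj₂ _) → refl })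
                               (λ { (zero , _) → refl ; (suc _ , _) → refl })
  where
  split : Σ (Fin _) Q → Q zero ⊎ Σ (Fin _) (Q ∘ suc)
  split (zero , q)  = inj₁ q
  split (suc i , q) = inj₂ (i , q)
  join : Q zero ⊎ Σ (Fin _) (Q ∘ suc) → Σ (Fin _) Q
  join (inj₁ q)       = zero , q
  join (inj₂ (i , q)) = suc i , q

T-size : ∀ b → HasSize (T b) (if b then 1 else 0)
T-size true  = mk↔ₛ′ (λ _ → zero) (λ _ → _) (λ { zero → refl }) (λ _ → refl)
T-size false = mk↔ₛ′ (λ ()) (λ ()) (λ ()) (λ ())

count : ∀ {n} → (Fin n → Bool) → ℕ
count {zero}  P = 0
count {suc n} P = (if P zero then 1 else 0) + count (P ∘ suc)

subset-size : ∀ {n} (P : Fin n → Bool) → HasSize (Σ (Fin n) (T ∘ P)) (count P)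
subset-size {zero}  P = mk↔ₛ′ (λ { (() , _) }) (λ ()) (λ ()) (λ { (() , _) })
subset-size {suc n} P =
  ↔-trans (Σ-Fin-suc (T ∘ P))
          (↔-trans (T-size (P zero) ⊎-↔ subset-size (P ∘ suc)) (↔-sym +↔⊎))

-- A retract of a finite type is finite: X ≅ {i : Fin n | s (r i) ≡ i},
-- a subset cut out by a decidable condition.
retract-finite : {X Y : Set} → Finite Y → (s : X → Y) (r : Y → X) →
                 (∀ x → r (s x) ≡ x) → Finite X
retract-finite {X} (n , Y↔Fin) s r r∘s = count P , ↔-trans X↔subset (subset-size P)
  where
  open Inverse Y↔Fin using (to; from; strictlyInverseʳ)
  s′ : X → Fin n
  s′ = to ∘ s
  r′ : Fin n → X
  r′ = r ∘ from
  r′∘s′ : ∀ x → r′ (s′ x) ≡ x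
  r′∘s′ x = trans (cong r (strictlyInverseʳ (s x))) (r∘s x)
  P : Fin n → Bool
  P i = ⌊ s′ (r′ i) ≟ i ⌋
  X↔subset : X ↔ Σ (Fin n) (T ∘ P)
  X↔subset = mk↔ₛ′ (λ x → s′ x , fromWitness {a? = s′ (r′ (s′ x)) ≟ s′ x} (cong s′ (r′∘s′ x)))
                   (λ (i , _) → r′ i)
                   (λ (i , t) → subset-≡ {P = P} (toWitness {a? = s′ (r′ i) ≟ i} t))
                   r′∘s′

Covers : {A : Set} {n : ℕ} → (Fin n → A) → (A → Set) → Set
Covers e P = ∀ x → P x → ∃ λ i → e i ≡ x

record Enumeration {A : Set} (P : A → Set) : Set where
  field
    size     : ℕ
    point    : Fin size → A
    valid    : ∀ i → P (point i)
    complete : Covers point P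

finite-enumeration : {A : Set} {P : A → Set} → Finite (Σ A P) → Enumeration P
finite-enumeration (n , ΣP↔Fin) = record
  { size     = n
  ; point    = proj₁ ∘ from
  ; valid    = proj₂ ∘ from
  ; complete = λ x p → to (x , p) , cong proj₁ (strictlyInverseʳ (x , p))
  }
  where open Inverse ΣP↔Fin using (to; from; strictlyInverseʳ)

covers-tail : {A : Set} {n : ℕ} {P : A → Set} (e : Fin (suc n) → A) →
              Covers e P → (∀ x → P x → x ≢ e zero) → Covers (e ∘ suc) P
covers-tail e cov avoids x px with cov x px
... | zero  , e₀≡x = ⊥-elim (avoids x px (sym e₀≡x))
... | suc i , eᵢ≡x = i , eᵢ≡x

Support : {A : Set} → (A → A) → Set
Support {A} f = Σ A λ x → f x ≢ x

Rest : {A : Set} → (A → A) → Set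
Rest {A} f = Σ A λ x → ¬ MoPre f x × ¬ Idp f x

record Confined {A : Set} (M : A → Set) (g : A → A) : Set where
  field
    stays : ∀ x → M x → M (g x)
    fixes : ∀ x → ¬ M x → g x ≡ x

confined-∘ : {A : Set} {M : A → Set} {g h : A → A} →
             Confined M g → Confined M h → Confined M (g ∘ h)
confined-∘ {g = g} cg ch = record
  { stays = λ x mx → Confined.stays cg _ (Confined.stays ch x mx)
  ; fixes = λ x nx → trans (cong g (Confined.fixes ch x nx)) (Confined.fixes cg x nx)
  }

-- Transpositions (classically, equality on A is decidable)

module _ (lem : ExcludedMiddle 0ℓ) {A : Set} where

  swap : A → A → A → A
  swap a b x with lem {x ≡ a} | lem {x ≡ b}
  ... | yes _ | _     = b
  ... | no _  | yes _ = a
  ... | no _  | no _  = x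

  swap-at-a : ∀ a b → swap a b a ≡ b
  swap-at-a a b with lem {a ≡ a} | lem {a ≡ b}
  ... | yes _  | _ = refl
  ... | no a≢a | _ = ⊥-elim (a≢a refl)

  swap-at-b : ∀ a b → swap a b b ≡ a
  swap-at-b a b with lem {b ≡ a} | lem {b ≡ b}
  ... | yes b≡a | _      = b≡a
  ... | no _    | yes _  = refl
  ... | no _    | no b≢b = ⊥-elim (b≢b refl)

  swap-elsewhere : ∀ a b x → x ≢ a → x ≢ b → swap a b x ≡ x
  swap-elsewhere a b x x≢a x≢b with lem {x ≡ a} | lem {x ≡ b}
  ... | yes x≡a | _       = ⊥-elim (x≢a x≡a)
  ... | no _    | yes x≡b = ⊥-elim (x≢b x≡b)
  ... | no _    | no _    = refl

  swap-involutive : ∀ a b x → swap a b (swap a b x) ≡ x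
  swap-involutive a b x with lem {x ≡ a} | lem {x ≡ b}
  ... | yes refl | _        = swap-at-b x b
  ... | no _     | yes refl = swap-at-a a x
  ... | no x≢a   | no x≢b   = swap-elsewhere a b x x≢a x≢b

  swap-injective : ∀ a b → Injective _≡_ _≡_ (swap a b)
  swap-injective a b {x} {y} eq =
    trans (sym (swap-involutive a b x)) (trans (cong (swap a b) eq) (swap-involutive a b y))

  agrees-with-swap : ∀ {a b} (t : A → A) → t a ≡ b → t b ≡ a →
                     (∀ x → x ≢ a → x ≢ b → t x ≡ x) → ∀ x → t x ≡ swap a b x
  agrees-with-swap {a} {b} t ta tb tx x with lem {x ≡ a} | lem {x ≡ b}
  ... | yes refl | _        = ta
  ... | no _     | yes refl = tb
  ... | no x≢a   | no x≢b   = tx x x≢a x≢b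

  swap-confined : ∀ {M : A → Set} {a b} → M a → M b → Confined M (swap a b)
  swap-confined {M} {a} {b} ma mb = record { stays = stays ; fixes = fixes }
    where
    stays : ∀ x → M x → M (swap a b x)
    stays x mx with lem {x ≡ a} | lem {x ≡ b}
    ... | yes _ | _     = mb
    ... | no _  | yes _ = ma
    ... | no _  | no _  = mx
    fixes : ∀ x → ¬ M x → swap a b x ≡ x
    fixes x nx = swap-elsewhere a b x (λ { refl → nx ma }) (λ { refl → nx mb })

  -- Two transpositions move a pair u ≠ w onto any prescribed pair p ≠ q.
  pair-swap : A → A → A → A → A → A
  pair-swap u w p q = swap (swap u p w) q ∘ swap u p

  pair-swap-first : ∀ {u w p q} → u ≢ w → p ≢ q → pair-swap u w p q u ≡ p
  pair-swap-first {u} {w} {p} {q} u≢w p≢q =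
    trans (cong (swap (swap u p w) q) (swap-at-a u p)) (swap-elsewhere _ q p p≢τw p≢q)
    where
    p≢τw : p ≢ swap u p w
    p≢τw p≡τw = u≢w (swap-injective u p (trans (swap-at-a u p) p≡τw))

  pair-swap-second : ∀ u w p q → pair-swap u w p q w ≡ q
  pair-swap-second u w p q = swap-at-a (swap u p w) q

  pair-swap-confined : ∀ {M : A → Set} {u w p q} → M u → M w → M p → M q →
                       Confined M (pair-swap u w p q)
  pair-swap-confined {M} {u} {w} mu mw mp mq =
    confined-∘ (swap-confined (Confined.stays (swap-confined {M} mu mp) w mw) mq) (swap-confined mu mp)

  -- Composing an injective h with the transposition (a, h a) fixes a and
  -- moves only points already moved by h: the support shrinks.
  swap-shrinks-support : ∀ {h : A → A} → Injective _≡_ _≡_ h → ∀ a x →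
                         swap a (h a) (h x) ≢ x → x ≢ a × h x ≢ x
  swap-shrinks-support {h} inj a x moved = x≢a , hx≢x
    where
    x≢a : x ≢ a
    x≢a refl = moved (swap-at-b a (h a))
    hx≢x : h x ≢ x
    hx≢x hx≡x = moved (trans (swap-elsewhere a (h a) (h x) (λ hx≡a → x≢a (trans (sym hx≡x) hx≡a))
                                                          (λ hx≡ha → x≢a (inj hx≡ha)))
                             hx≡x)

  -- Induction over finitely supported injections: a property of maps that
  -- respects pointwise equality, holds for the identity and is preserved by
  -- composing with transpositions holds for every injective map whose moved
  -- points are covered by a finite family.  (Peel off e zero by a transposition.)
  finitary-induction : (Q : (A → A) → Set) →
    (∀ {g h} → (∀ x → g x ≡ h x) → Q g → Q h) → Q (λ x → x) →
    (∀ a b {h} → Q h → Q (swap a b ∘ h)) →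
    ∀ {n} (e : Fin n → A) (h : A → A) → Injective _≡_ _≡_ h → Covers e (λ x → h x ≢ x) → Q h
  finitary-induction Q ext Qid Qswap {zero} e h inj cov = ext fixed Qid
    where
    fixed : ∀ x → x ≡ h x
    fixed x = sym (decidable-stable lem (λ hx≢x → ¬Fin0 (proj₁ (cov x hx≢x))))
  finitary-induction Q ext Qid Qswap {suc n} e h inj cov =
    ext (λ x → swap-involutive a (h a) (h x))
        (Qswap a (h a) (finitary-induction Q ext Qid Qswap (e ∘ suc) h′ inj′ cov′))
    where
    a = e zero
    h′ : A → A
    h′ = swap a (h a) ∘ h
    inj′ : Injective _≡_ _≡_ h′
    inj′ = inj ∘ swap-injective a (h a)
    cov′ : Covers (e ∘ suc) (λ x → h′ x ≢ x)
    cov′ = covers-tail e (λ x moved → cov x (proj₂ (swap-shrinks-support inj a x moved)))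
                         (λ x moved → proj₁ (swap-shrinks-support inj a x moved))

  finitary-onto : ∀ {n} (e : Fin n → A) (h : A → A) → Injective _≡_ _≡_ h →
                  Covers e (λ x → h x ≢ x) → StrictlySurjective _≡_ h
  finitary-onto = finitary-induction (StrictlySurjective _≡_) onto-ext (λ y → y , refl) swap-onto
    where
    onto-ext : ∀ {g h} → (∀ x → g x ≡ h x) → StrictlySurjective _≡_ g → StrictlySurjective _≡_ h
    onto-ext g≗h onto y with onto y
    ... | x , gx≡y = x , trans (sym (g≗h x)) gx≡y
    swap-onto : ∀ a b {h} → StrictlySurjective _≡_ h → StrictlySurjective _≡_ (swap a b ∘ h)
    swap-onto a b onto y with onto (swap a b y)
    ... | x , hx≡y′ = x , trans (cong (swap a b) hx≡y′) (swap-involutive a b y)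

-- Fully-transpositional semigroups

  module _ {S : (A → A) → Set} (FS : FunctionSemigroup S) (FT : FullyTranspositional S) where
    open FunctionSemigroup FS

    transposition∈S : ∀ {a b} → a ≢ b → S (swap a b)
    transposition∈S {a} {b} a≢b with FT a b a≢b
    ... | t , St , ta , tb , tx = extensional (agrees-with-swap t ta tb tx) St

    -- S contains the identity: S has no constant map, so A has two distinct
    -- points, and the square of a transposition is the identity.
    id∈S : ¬ HasSize A 1 → ¬ Σ (A → A) (λ g → S g × IsConstant g) → S (λ x → x)
    id∈S not-singleton no-constant with lem {A}
    ... | no empty = ⊥-elim (no-constant (g , Sg , λ x → ⊥-elim (empty x)))
      where open Σ nonempty renaming (proj₁ to g; proj₂ to Sg)
    ... | yes a with lem {Σ A λ b → b ≢ a}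
    ... | yes (b , b≢a) = extensional (swap-involutive b a) (closed (transposition∈S b≢a) (transposition∈S b≢a))
    ... | no only-a = ⊥-elim (not-singleton (mk↔ₛ′ (λ _ → zero) (λ _ → a) (λ { zero → refl }) all-a))
      where
      all-a : ∀ x → a ≡ x
      all-a x = sym (decidable-stable lem (λ x≢a → only-a (x , x≢a)))

    module _ (Sid : S (λ x → x)) where

      swap∈S : ∀ a b → S (swap a b)
      swap∈S a b with lem {a ≡ b}
      ... | yes refl = extensional (agrees-with-swap (λ x → x) refl refl (λ _ _ _ → refl)) Sid
      ... | no a≢b   = transposition∈S a≢b

      finitary∈S : ∀ {n} (e : Fin n → A) (h : A → A) → Injective _≡_ _≡_ h →
                   Covers e (λ x → h x ≢ x) → S h
      finitary∈S = finitary-induction S extensional Sid (λ a b Sh → closed (swap∈S a b) Sh)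

      -- A permutation in S moving only finitely many points lies in Gr(S):
      -- its inverse is again injective with the same finite support.
      finitary-permutation∈Gr : ∀ {f} → S f → IsPermutation f →
                                Finite (Σ A λ x → f x ≢ x) → InGr S f
      finitary-permutation∈Gr {f} Sf (inj , surj) fin =
        Sf , (inj , surj) , f⁻¹ , finitary∈S point f⁻¹ f⁻¹-injective cov , f⁻¹∘f , f∘f⁻¹
        where
        open Enumeration (finite-enumeration fin)
        f⁻¹ : A → A
        f⁻¹ y = proj₁ (surj y)
        f∘f⁻¹ : ∀ y → f (f⁻¹ y) ≡ y
        f∘f⁻¹ y = proj₂ (surj y) refl
        f⁻¹∘f : ∀ x → f⁻¹ (f x) ≡ x
        f⁻¹∘f x = inj (f∘f⁻¹ (f x))
        f⁻¹-injective : Injective _≡_ _≡_ f⁻¹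
        f⁻¹-injective {x} {y} eq = trans (sym (f∘f⁻¹ x)) (trans (cong f eq) (f∘f⁻¹ y))
        cov : Covers point (λ y → f⁻¹ y ≢ y)
        cov y moved = complete y (λ fy≡y → moved (trans (sym (cong f⁻¹ fy≡y)) (f⁻¹∘f y)))

      -- If all members of e equal e 0,
      -- g is itself semi-constant on M.  Otherwise take u = e (suc i) ≠ e 0 = w
      -- and τ ∈ S confined to M with τ u ≡ p, τ w ≡ q; then g ∘ τ ∘ g has the
      -- same properties, and its image on M is covered by the shorter family
      -- g ∘ τ ∘ e ∘ suc, because g (τ w) ≡ g q ≡ g p ≡ g (τ u).
      collapse : ∀ {M : A → Set} {p q} → p ≢ q → M p → M q →
                 ∀ {n} (e : Fin n → A) → (∀ i → M (e i)) →
                 (g : A → A) → S g → Confined M g → g p ≡ g q →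
                 (∀ x → M x → ∃ λ i → e i ≡ g x) →
                 Σ (A → A) λ g → S g × IsSemiConstant g
      collapse p≢q Mp Mq {zero} e eM g Sg cg gp≡gq image =
        ⊥-elim (¬Fin0 (proj₁ (image _ Mp)))
      collapse {M} {p} {q} p≢q Mp Mq {suc n} e eM g Sg cg gp≡gq image
        with lem {Σ (Fin n) λ i → e (suc i) ≢ e zero}
      ... | no all-equal =
        g , Sg , M , (p , q , p≢q , Mp , Mq) , constant , Confined.fixes cg
        where
        value : ∀ x → M x → g x ≡ e zero
        value x mx with image x mx
        ... | zero  , e₀≡gx = sym e₀≡gx
        ... | suc i , eᵢ≡gx = trans (sym eᵢ≡gx) (decidable-stable lem (λ ne → all-equal (i , ne)))
        constant : ∀ x y → M x → M y → g x ≡ g y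
        constant x y mx my = trans (value x mx) (sym (value y my))
      ... | yes (i , u≢w) =
        collapse p≢q Mp Mq (g ∘ τ ∘ e ∘ suc) eM′ (g ∘ τ ∘ g)
                 (closed Sg (closed Sτ Sg)) (confined-∘ cg (confined-∘ cτ cg))
                 (cong (g ∘ τ) gp≡gq) image′
        where
        u = e (suc i)
        w = e zero
        τ : A → A
        τ = pair-swap u w p q
        Sτ : S τ
        Sτ = closed (swap∈S _ q) (swap∈S u p)
        cτ : Confined M τ
        cτ = pair-swap-confined (eM (suc i)) (eM zero) Mp Mq
        eM′ : ∀ j → M (g (τ (e (suc j))))
        eM′ j = Confined.stays cg _ (Confined.stays cτ _ (eM (suc j)))
        image′ : ∀ x → M x → ∃ λ j → g (τ (e (suc j))) ≡ g (τ (g x))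
        image′ x mx with image x mx
        ... | suc j , eⱼ≡gx = j , cong (g ∘ τ) eⱼ≡gx
        ... | zero  , w≡gx  = i , (begin
          g (τ u)      ≡⟨ cong g (pair-swap-first u≢w p≢q) ⟩
          g p          ≡⟨ gp≡gq ⟩
          g q          ≡⟨ cong g (sym (pair-swap-second u w p q)) ⟩
          g (τ w)      ≡⟨ cong (g ∘ τ) w≡gx ⟩
          g (τ (g x))  ∎)
          where open ≡-Reasoning

  module _ (f : A → A) where

    -- A point of Mo-pre(f) shares its fibre with another point, so it is
    -- not in Idp(f).
    mopre⇒¬idp : ∀ {z} → MoPre f z → ¬ Idp f z
    mopre⇒¬idp {z} (a , (x , y , x≢y , fx≡fa , fy≡fa) , fz≡fa) idp =
      x≢y (trans (in-fibre x fx≡fa) (sym (in-fibre y fy≡fa)))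
      where
      in-fibre : ∀ t → f t ≡ f a → t ≡ z
      in-fibre t ft≡fa = proj₁ (idp t) (trans ft≡fa (trans (sym fz≡fa) (proj₂ (idp z) refl)))

    f-confined : Confined (λ x → ¬ Idp f x) f
    f-confined = record { stays = stays ; fixes = λ x ¬¬idp → proj₂ (decidable-stable lem ¬¬idp x) refl }
      where
      stays : ∀ x → ¬ Idp f x → ¬ Idp f (f x)
      stays x ¬idp idp-fx = ¬idp (subst (Idp f) (sym (proj₁ (idp-fx x) refl)) idp-fx)

    no-class⇒injective : ¬ Σ A (InB f) → Injective _≡_ _≡_ f
    no-class⇒injective none {x} {y} fx≡fy =
      decidable-stable lem (λ x≢y → none (x , x , y , x≢y , refl , sym fx≡fy))

    class-values : BAtMostTwo f → ∀ {a} → InB f a →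
                   Σ A λ b → InB f b × (∀ c → InB f c → f c ≡ f a ⊎ f c ≡ f b)
    class-values B2 {a} inb-a with lem {Σ A λ b → InB f b × f b ≢ f a}
    ... | no only-a = a , inb-a , λ c inb-c →
      inj₁ (decidable-stable lem (λ fc≢fa → only-a (c , inb-c , fc≢fa)))
    ... | yes (b , inb-b , fb≢fa) = b , inb-b , classify
      where
      classify : ∀ c → InB f c → f c ≡ f a ⊎ f c ≡ f b
      classify c inb-c with B2 a b c inb-a inb-b inb-c
      ... | inj₁ a~b        = ⊥-elim (fb≢fa (sym (proj₁ (a~b a) refl)))
      ... | inj₂ (inj₁ a~c) = inj₁ (proj₂ (a~c c) refl)
      ... | inj₂ (inj₂ b~c) = inj₂ (proj₂ (b~c c) refl)

    -- Case B(f) = ∅ with Rest f finite: f is injective, its support is a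
    -- retract of Rest f, and f is onto.  This is alternative (i).
    no-class-case : ¬ Σ A (InB f) → Finite (Rest f) → IsPermutation f × Finite (Support f)
    no-class-case none fin-rest =
      (inj , strictlySurjective⇒surjective (finitary-onto point f inj complete)) , fin-support
      where
      inj = no-class⇒injective none
      fixed⇒idp : ∀ x → f x ≡ x → Idp f x
      fixed⇒idp x fx≡x y = (λ fy≡x → inj (trans fy≡x (sym fx≡x))) , (λ { refl → fx≡x })
      fin-support : Finite (Support f)
      fin-support = retract-finite fin-rest
        (λ (x , fx≢x) → x , (λ (a , inb , _) → none (a , inb)) , (λ idp → fx≢x (proj₂ (idp x) refl)))
        (λ (x , _ , ¬idp) → x , (λ fx≡x → ¬idp (fixed⇒idp x fx≡x)))
        (λ _ → refl)
      open Enumeration (finite-enumeration fin-support)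

  -- Case B(f) ≠ ∅ with Rest f finite: f maps the complement M of Idp(f) into
  -- the finite family  f a, f b, f (rest points), and two points of one class
  -- of B(f) lie in M, so collapsing yields a semi-constant map in S.
  class-case : {S : (A → A) → Set} (FS : FunctionSemigroup S) (FT : FullyTranspositional S) →
               S (λ x → x) → ∀ {f} → S f → BAtMostTwo f → Σ A (InB f) → Finite (Rest f) →
               Σ (A → A) λ g → S g × IsSemiConstant g
  class-case FS FT Sid {f} Sf B2 (a , inb-a@(x , y , x≢y , fx≡fa , fy≡fa)) fin-rest
    with class-values f B2 inb-a
  ... | b , inb-b , values =
    collapse FS FT Sid x≢y (mopre⇒¬idp f (a , inb-a , fx≡fa)) (mopre⇒¬idp f (a , inb-a , fy≡fa))
             family family-in-M f Sf (f-confined f) (trans fx≡fa (sym fy≡fa)) image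
    where
    open Enumeration (finite-enumeration fin-rest)
    M : A → Set
    M z = ¬ Idp f z
    family : Fin (suc (suc size)) → A
    family = f a ∷ f b ∷ f ∘ point
    family-in-M : ∀ i → M (family i)
    family-in-M zero          = Confined.stays (f-confined f) a (mopre⇒¬idp f (a , inb-a , refl))
    family-in-M (suc zero)    = Confined.stays (f-confined f) b (mopre⇒¬idp f (b , inb-b , refl))
    family-in-M (suc (suc i)) = Confined.stays (f-confined f) (point i) (proj₂ (valid i))
    image : ∀ z → M z → ∃ λ i → family i ≡ f z
    image z mz with lem {MoPre f z}
    ... | yes (c , inb-c , fz≡fc) with values c inb-c
    ...   | inj₁ fc≡fa = zero , sym (trans fz≡fc fc≡fa)
    ...   | inj₂ fc≡fb = suc zero , sym (trans fz≡fc fc≡fb)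
    image z mz | no ¬mopre with complete z (¬mopre , mz)
    ...   | i , pᵢ≡z = suc (suc i) , cong f pᵢ≡z

mainTheorem15 : ExcludedMiddle 0ℓ →
    {A : Set} → ¬ HasSize A 1 → ¬ HasSize A 2 → ¬ HasSize A 6 →
    (S : (A → A) → Set) → FunctionSemigroup S → FullyTranspositional S →
    (¬ Σ (A → A) λ g → S g × IsConstant g) →
    (¬ Σ (A → A) λ g → S g × IsSemiConstant g) →
    (f : A → A) → S f → BAtMostTwo f →
    ((IsPermutation f × Finite (Σ A λ x → f x ≢ x))
      ⊎ Infinite (Σ A λ x → ¬ MoPre f x × ¬ Idp f x))
    × ((IsPermutation f × Finite (Σ A λ x → f x ≢ x)) → InGr S f)
mainTheorem15 lem not-1 _ _ S FS FT no-constant no-semiconstant f Sf B2 =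
  dichotomy , λ (perm , fin) → finitary-permutation∈Gr lem FS FT Sid Sf perm fin
  where
  Sid : S (λ x → x)
  Sid = id∈S lem FS FT not-1 no-constant
  dichotomy : (IsPermutation f × Finite (Support f)) ⊎ Infinite (Rest f)
  dichotomy with lem {Finite (Rest f)} | lem {Σ _ (InB f)}
  ... | no infinite | _        = inj₂ infinite
  ... | yes finite  | no none  = inj₁ (no-class-case lem f none finite)
  ... | yes finite  | yes some = ⊥-elim (no-semiconstant (class-case lem FS FT Sid Sf B2 some finite))
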